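{- Let $c > 0$. Any deterministic algorithm that, for every undirected graph on $[n]$ with non-negative edge weights, estimates the max cut value within a factor of $c$ using cut queries must make at least $\lg n$ queries. This holds even when inputs are restricted to unweighted graphs (edge weights in $\{0,1\}$); in particular the deterministic query complexity is $\Omega(\log n)$.
   Context: Cut query model: an undirected graph on $[n]$ has non-negative edge weights $w_{i,j}$ and cut function $F(S) = \sum_{i \in S, j \notin S} w_{i,j}$; the algorithm accesses the graph only by submitting sets $S \subseteq [n]$ and receiving $F(S)$ (adaptively, unlimited computation). With $\mathrm{OPT} = \max_S F(S)$, estimating the max cut value within a factor of $c$ means outputting a number $v$ with $c\cdot\mathrm{OPT} \le v \le \mathrm{OPT}$. $\lg$ denotes base-2 logarithm.
   Formalization: The factor c ranges over the positive rationals and the algorithms output rational estimates, branching on rational answers, while the edge weights are taken in ℚ. -}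

module Defs where

open import Data.Nat using (ℕ; zero; suc; _≤_)
open import Data.Bool using (Bool; true; false; _∧_; not; if_then_else_)
open import Data.Fin using (Fin; zero; suc)
open import Data.Fin.Subset using (Subset)
open import Data.Vec using (lookup)
open import Data.Rational using (ℚ; 0ℚ; 1ℚ; _+_; _*_) renaming (_≤_ to _≤ℚ_)
open import Data.Product using (_×_; ∃)
open import Data.Sum using (_⊎_)
open import Relation.Binary.PropositionalEquality using (_≡_)

Σ : ∀ {n} → (Fin n → ℚ) → ℚ
Σ {zero}  f = 0ℚ
Σ {suc n} f = f zero + Σ (λ i → f (suc i))

-- A weighted undirected graph on [n] (vertices Fin n): symmetric, non-negative
-- weights.  (Diagonal entries never contribute to any cut.)
record WGraph (n : ℕ) : Set where
  field
    w     : Fin n → Fin n → ℚ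
    sym   : ∀ i j → w i j ≡ w j i
    nonneg : ∀ i j → 0ℚ ≤ℚ w i j
open WGraph public

Unweighted : ∀ {n} → WGraph n → Set
Unweighted G = ∀ i j → (w G i j ≡ 0ℚ) ⊎ (w G i j ≡ 1ℚ)

cut : ∀ {n} → WGraph n → Subset n → ℚ
cut G S = Σ (λ i → Σ (λ j →
  if lookup S i ∧ not (lookup S j) then w G i j else 0ℚ))

IsMaxCut : ∀ {n} → WGraph n → ℚ → Set
IsMaxCut G m = ∃ (λ S → cut G S ≡ m) × (∀ S → cut G S ≤ℚ m)

Estimates : ∀ {n} → ℚ → WGraph n → ℚ → Set
Estimates c G v = ∀ m → IsMaxCut G m → (c * m ≤ℚ v) × (v ≤ℚ m)

-- Deterministic adaptive cut-query algorithm on [n]: a decision tree whose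
-- internal nodes query a set S ⊆ [n] and branch on the answer F(S), and whose
-- leaves output an estimate.
data Alg (n : ℕ) : Set where
  output : ℚ → Alg n
  query  : Subset n → (ℚ → Alg n) → Alg n

run : ∀ {n} → Alg n → WGraph n → ℚ
run (output v)  G = v
run (query S k) G = run (k (cut G S)) G

queries : ∀ {n} → Alg n → WGraph n → ℕ
queries (output v)  G = 0
queries (query S k) G = suc (queries (k (cut G S)) G)

-- Run the algorithm on the empty graph and let S₁, …, S_q be the sets it
-- queries. Membership in them gives every vertex a signature in {0,1}^q, so if
-- q < ⌈log₂ n⌉, i.e. 2^q < n, two distinct vertices i and j share a signature.
-- No queried set separates i from j, so the graph with the single edge ij
-- answers all these queries with 0, exactly like the empty graph, and the
-- algorithm outputs the same value v on both. The empty graph forces v ≤ 0,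
-- whereas the edge graph has a positive max cut and forces v > 0.
module Submission where

open import Defs
open import Data.Nat using (ℕ; _≤_)
open import Data.Nat.Logarithm using (⌈log₂_⌉)
open import Data.Rational using (ℚ; 0ℚ; _<_)
open import Data.Product using (_×_; ∃)

open import Data.Bool using (Bool; true; false; _∧_; _∨_; not; if_then_else_)
open import Data.Bool.Properties using (∧-comm; ∨-comm; ∧-inverseʳ)
open import Data.Fin as Fin using (Fin; combine; _≟_)
open import Data.Fin.Properties using (pigeonhole; combine-injective; <⇒≢)
open import Data.Fin.Subset using (Subset; _∈_; _∉_; ⁅_⁆)
open import Data.Fin.Subset.Properties using (x∈⁅x⁆; x≢y⇒x∉⁅y⁆)
open import Data.List using (List; []; _∷_; length)
open import Data.List.Relation.Unary.All as All using (All; []; _∷_)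
import Data.Nat as ℕ
import Data.Nat.Properties as ℕ
open import Data.Nat.Logarithm using (⌈log₂⌉-mono-≤; ⌈log₂2^n⌉≡n)
open import Data.Product using (_,_; proj₁; proj₂)
open import Data.Rational using (1ℚ; _*_; positive) renaming (_≤_ to _≤ℚ_)
import Data.Rational.Properties as ℚ
open import Data.Sum using (_⊎_; inj₁; inj₂)
open import Data.Vec using (_∷_; []; lookup; replicate)
open import Data.Vec.Properties using ([]=⇒lookup; lookup⇒[]=)
open import Function using (_∘_)
open import Relation.Nullary using (¬_; yes; no; does; contradiction)
open import Relation.Nullary.Decidable using (dec-true)
open import Relation.Binary.PropositionalEquality
  using (_≡_; refl; trans; cong; cong₂; subst; _≢_)
  renaming (sym to ≡-sym)

private
  variable
    n : ℕ

Σ-zero : (f : Fin n → ℚ) → (∀ i → f i ≡ 0ℚ) → Σ f ≡ 0ℚ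
Σ-zero {ℕ.zero}  f f≡0 = refl
Σ-zero {ℕ.suc n} f f≡0
  rewrite f≡0 Fin.zero | Σ-zero (f ∘ Fin.suc) (f≡0 ∘ Fin.suc) = refl

0≤Σ : (f : Fin n → ℚ) → (∀ i → 0ℚ ≤ℚ f i) → 0ℚ ≤ℚ Σ f
0≤Σ {ℕ.zero}  f 0≤f = ℚ.≤-refl
0≤Σ {ℕ.suc n} f 0≤f =
  subst (_≤ℚ Σ f) (ℚ.+-identityˡ 0ℚ)
    (ℚ.+-mono-≤ (0≤f Fin.zero) (0≤Σ (f ∘ Fin.suc) (0≤f ∘ Fin.suc)))

≤Σ : (f : Fin n → ℚ) → (∀ i → 0ℚ ≤ℚ f i) → ∀ k → f k ≤ℚ Σ f
≤Σ f 0≤f Fin.zero =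
  subst (_≤ℚ Σ f) (ℚ.+-identityʳ (f Fin.zero))
    (ℚ.+-monoʳ-≤ (f Fin.zero) (0≤Σ (f ∘ Fin.suc) (0≤f ∘ Fin.suc)))
≤Σ f 0≤f (Fin.suc k) =
  ℚ.≤-trans (≤Σ (f ∘ Fin.suc) (0≤f ∘ Fin.suc) k)
    (subst (_≤ℚ Σ f) (ℚ.+-identityˡ _)
      (ℚ.+-monoˡ-≤ (Σ (f ∘ Fin.suc)) (0≤f Fin.zero)))

cutTerm : WGraph n → Subset n → Fin n → Fin n → ℚ
cutTerm G S i j = if lookup S i ∧ not (lookup S j) then w G i j else 0ℚ

0≤cutTerm : (G : WGraph n) (S : Subset n) → ∀ i j → 0ℚ ≤ℚ cutTerm G S i j
0≤cutTerm G S i j with lookup S i ∧ not (lookup S j)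
... | true  = nonneg G i j
... | false = ℚ.≤-refl

cut≡0 : (G : WGraph n) (S : Subset n) →
        (∀ i j → w G i j ≡ 0ℚ ⊎ lookup S i ≡ lookup S j) → cut G S ≡ 0ℚ
cut≡0 G S uncut = Σ-zero _ λ i → Σ-zero _ λ j → term≡0 i j (uncut i j)
  where
  term≡0 : ∀ i j → w G i j ≡ 0ℚ ⊎ lookup S i ≡ lookup S j → cutTerm G S i j ≡ 0ℚ
  term≡0 i j (inj₁ wᵢⱼ≡0) with lookup S i ∧ not (lookup S j)
  ... | true  = wᵢⱼ≡0
  ... | false = refl
  term≡0 i j (inj₂ Sᵢ≡Sⱼ) rewrite Sᵢ≡Sⱼ | ∧-inverseʳ (lookup S j) = refl

∉⇒lookup≡false : (S : Subset n) (j : Fin n) → j ∉ S → lookup S j ≡ false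
∉⇒lookup≡false S j j∉S with lookup S j in Sⱼ≡b
... | true  = contradiction (lookup⇒[]= j S Sⱼ≡b) j∉S
... | false = refl

w≤cut : (G : WGraph n) {S : Subset n} {i j : Fin n} → i ∈ S → j ∉ S →
        w G i j ≤ℚ cut G S
w≤cut G {S} {i} {j} i∈S j∉S =
  ℚ.≤-trans (ℚ.≤-reflexive (≡-sym wᵢⱼ≡term))
    (ℚ.≤-trans (≤Σ (cutTerm G S i) (0≤cutTerm G S i) j)
      (≤Σ (λ a → Σ (cutTerm G S a)) (λ a → 0≤Σ _ (0≤cutTerm G S a)) i))
  where
  wᵢⱼ≡term : cutTerm G S i j ≡ w G i j
  wᵢⱼ≡term rewrite []=⇒lookup i∈S | ∉⇒lookup≡false S j j∉S = refl

argmax : (f : Subset n → ℚ) → ∃ λ S → ∀ T → f T ≤ℚ f S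
argmax {ℕ.zero}  f = [] , λ { [] → ℚ.≤-refl }
argmax {ℕ.suc n} f
  with argmax (f ∘ (true ∷_)) | argmax (f ∘ (false ∷_))
... | S₁ , max₁ | S₀ , max₀ with ℚ.≤-total (f (true ∷ S₁)) (f (false ∷ S₀))
... | inj₁ ≤₀ = false ∷ S₀ , λ { (true ∷ T) → ℚ.≤-trans (max₁ T) ≤₀ ; (false ∷ T) → max₀ T }
... | inj₂ ≤₁ = true ∷ S₁ , λ { (true ∷ T) → max₁ T ; (false ∷ T) → ℚ.≤-trans (max₀ T) ≤₁ }

maxCut : (G : WGraph n) → ∃ (IsMaxCut G)
maxCut G with argmax (cut G)
... | S , max = cut G S , (S , refl) , max

0<estimate : ∀ {c v m} → 0ℚ < c → 0ℚ < m → (G : WGraph n) →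
             IsMaxCut G m → Estimates c G v → 0ℚ < v
0<estimate {c = c} {m = m} 0<c 0<m G opt est =
  ℚ.<-≤-trans 0<cm (proj₁ (est m opt))
  where
  instance
    _ = positive 0<c
    _ = positive 0<m
  0<cm : 0ℚ < c * m
  0<cm = ℚ.positive⁻¹ _ {{ℚ.pos*pos⇒pos c m}}

empty : ∀ n → WGraph n
empty n = record { w = λ _ _ → 0ℚ ; sym = λ _ _ → refl ; nonneg = λ _ _ → ℚ.≤-refl }

empty-unweighted : Unweighted (empty n)
empty-unweighted _ _ = inj₁ refl

cut-empty : (S : Subset n) → cut (empty n) S ≡ 0ℚ
cut-empty S = cut≡0 (empty _) S λ _ _ → inj₁ refl

empty-isMaxCut : IsMaxCut (empty n) 0ℚ
empty-isMaxCut {n} =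
  (replicate n false , cut-empty (replicate n false)) , λ S → subst (_≤ℚ 0ℚ) (≡-sym (cut-empty S)) ℚ.≤-refl

fromAdjacency : (E : Fin n → Fin n → Bool) → (∀ i j → E i j ≡ E j i) → WGraph n
fromAdjacency E E-sym = record
  { w      = weight
  ; sym    = λ i j → cong (if_then 1ℚ else 0ℚ) (E-sym i j)
  ; nonneg = nonneg′
  }
  where
  weight : Fin _ → Fin _ → ℚ
  weight i j = if E i j then 1ℚ else 0ℚ
  nonneg′ : ∀ i j → 0ℚ ≤ℚ weight i j
  nonneg′ i j with E i j
  ... | true  = ℚ.<⇒≤ (ℚ.positive⁻¹ 1ℚ)
  ... | false = ℚ.≤-refl

fromAdjacency-unweighted : ∀ E E-sym → Unweighted (fromAdjacency {n} E E-sym)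
fromAdjacency-unweighted E _ i j with E i j
... | true  = inj₂ refl
... | false = inj₁ refl

module SingleEdge (i j : Fin n) (i≢j : i ≢ j) where

  adjacent : Fin n → Fin n → Bool
  adjacent a b = does (a ≟ i) ∧ does (b ≟ j) ∨ does (a ≟ j) ∧ does (b ≟ i)

  adjacent-sym : ∀ a b → adjacent a b ≡ adjacent b a
  adjacent-sym a b =
    trans (∨-comm (does (a ≟ i) ∧ does (b ≟ j)) _)
      (cong₂ _∨_ (∧-comm (does (a ≟ j)) _) (∧-comm (does (a ≟ i)) _))

  graph : WGraph n
  graph = fromAdjacency adjacent adjacent-sym

  unweighted : Unweighted graph
  unweighted = fromAdjacency-unweighted adjacent adjacent-sym

  cut≡0-unseparated : (S : Subset n) → lookup S i ≡ lookup S j → cut graph S ≡ 0ℚ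
  cut≡0-unseparated S Sᵢ≡Sⱼ = cut≡0 graph S uncut
    where
    uncut : ∀ a b → w graph a b ≡ 0ℚ ⊎ lookup S a ≡ lookup S b
    uncut a b with a ≟ i | b ≟ j | a ≟ j | b ≟ i
    ... | yes refl | yes refl | _       | _       = inj₂ Sᵢ≡Sⱼ
    ... | _        | _        | yes refl | yes refl = inj₂ (≡-sym Sᵢ≡Sⱼ)
    ... | no _     | _        | no _    | _       = inj₁ refl
    ... | no _     | _        | yes _   | no _    = inj₁ refl
    ... | yes _    | no _     | no _    | _       = inj₁ refl
    ... | yes _    | no _     | yes _   | no _    = inj₁ refl

  0<maxCut : ∀ {m} → IsMaxCut graph m → 0ℚ < m
  0<maxCut (_ , max) =
    ℚ.<-≤-trans (ℚ.positive⁻¹ 1ℚ)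
      (ℚ.≤-trans (subst (_≤ℚ cut graph ⁅ i ⁆) wᵢⱼ≡1 (w≤cut graph (x∈⁅x⁆ i) (x≢y⇒x∉⁅y⁆ (i≢j ∘ ≡-sym))))
        (max ⁅ i ⁆))
    where
    wᵢⱼ≡1 : w graph i j ≡ 1ℚ
    wᵢⱼ≡1 rewrite dec-true (i ≟ i) refl | dec-true (j ≟ j) refl = refl

queried : Alg n → WGraph n → List (Subset n)
queried (output v)  G = []
queried (query S k) G = S ∷ queried (k (cut G S)) G

length-queried : (A : Alg n) (G : WGraph n) → length (queried A G) ≡ queries A G
length-queried (output v)  G = refl
length-queried (query S k) G = cong ℕ.suc (length-queried (k (cut G S)) G)

run-agrees : (A : Alg n) (G H : WGraph n) →
             All (λ S → cut H S ≡ cut G S) (queried A G) → run A H ≡ run A G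
run-agrees (output v)  G H []       = refl
run-agrees (query S k) G H (e ∷ es) rewrite e = run-agrees (k (cut G S)) G H es

bitToFin : Bool → Fin 2
bitToFin true  = Fin.zero
bitToFin false = Fin.suc Fin.zero

bitToFin-injective : ∀ x y → bitToFin x ≡ bitToFin y → x ≡ y
bitToFin-injective true  true  _ = refl
bitToFin-injective false false _ = refl

signature : (L : List (Subset n)) → Fin n → Fin (2 ℕ.^ length L)
signature []      a = Fin.zero
signature (S ∷ L) a = combine (bitToFin (lookup S a)) (signature L a)

signature-injective : (L : List (Subset n)) → ∀ a b → signature L a ≡ signature L b →
                      All (λ S → lookup S a ≡ lookup S b) L
signature-injective []      a b _ = []
signature-injective (S ∷ L) a b eq with combine-injective _ _ _ _ eq
... | eq₁ , eq₂ = bitToFin-injective _ _ eq₁ ∷ signature-injective L a b eq₂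

unseparated-pair : (L : List (Subset n)) → 2 ℕ.^ length L ℕ.< n →
                   ∃ λ i → ∃ λ j → i ≢ j × All (λ S → lookup S i ≡ lookup S j) L
unseparated-pair L 2^q<n with pigeonhole 2^q<n (signature L)
... | i , j , i<j , eq = i , j , <⇒≢ i<j , signature-injective L i j eq

≤2^⇒⌈log₂⌉≤ : ∀ {n} k → n ≤ 2 ℕ.^ k → ⌈log₂ n ⌉ ≤ k
≤2^⇒⌈log₂⌉≤ k n≤2^k = subst (_ ≤_) (⌈log₂2^n⌉≡n k) (⌈log₂⌉-mono-≤ n≤2^k)

queries-empty-separate : ∀ {c} → 0ℚ < c → (A : Alg n) →
  (∀ (G : WGraph n) → Unweighted G → Estimates c G (run A G)) →
  ∀ i j → i ≢ j → ¬ All (λ S → lookup S i ≡ lookup S j) (queried A (empty n))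
queries-empty-separate {n} 0<c A est i j i≢j unseparated =
  ℚ.<-irrefl refl (ℚ.<-≤-trans 0<v v≤0)
  where
  open SingleEdge i j i≢j
  v≤0 : run A (empty n) ≤ℚ 0ℚ
  v≤0 = proj₂ (est (empty n) empty-unweighted 0ℚ empty-isMaxCut)
  same-run : run A graph ≡ run A (empty n)
  same-run = run-agrees A (empty n) graph
    (All.map (λ {S} Sᵢ≡Sⱼ → trans (cut≡0-unseparated S Sᵢ≡Sⱼ) (≡-sym (cut-empty S)))
      unseparated)
  opt = maxCut graph
  0<v : 0ℚ < run A (empty n)
  0<v = subst (0ℚ <_) same-run
    (0<estimate 0<c (0<maxCut (proj₂ opt)) graph (proj₂ opt) (est graph unweighted))

⌈log₂⌉≤queries-empty : ∀ {c} → 0ℚ < c → (A : Alg n) →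
  (∀ (G : WGraph n) → Unweighted G → Estimates c G (run A G)) →
  ⌈log₂ n ⌉ ≤ queries A (empty n)
⌈log₂⌉≤queries-empty {n} 0<c A est
  rewrite ≡-sym (length-queried A (empty n)) with n ℕ.≤? 2 ℕ.^ length (queried A (empty n))
... | yes n≤2^q = ≤2^⇒⌈log₂⌉≤ _ n≤2^q
... | no  n≰2^q with unseparated-pair (queried A (empty n)) (ℕ.≰⇒> n≰2^q)
...   | i , j , i≢j , unseparated =
  contradiction unseparated (queries-empty-separate 0<c A est i j i≢j)

corollaryC3 : (c : ℚ) → 0ℚ < c → (n : ℕ) →
    ((A : Alg n) → (∀ (G : WGraph n) → Estimates c G (run A G)) →
    ∃ (λ (G : WGraph n) → ⌈log₂ n ⌉ ≤ queries A G))
    × ((A : Alg n) → (∀ (G : WGraph n) → Unweighted G → Estimates c G (run A G)) →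
    ∃ (λ (G : WGraph n) → Unweighted G × ⌈log₂ n ⌉ ≤ queries A G))
corollaryC3 c 0<c n =
  (λ A est → empty n , ⌈log₂⌉≤queries-empty 0<c A (λ G _ → est G)) ,
  (λ A est → empty n , empty-unweighted , ⌈log₂⌉≤queries-empty 0<c A est)
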